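{- Let $G(V,E)$ be a finite simple undirected graph, $M$ a matching in $G$, and $v_0$ an $M$-free vertex. Run the trunk search procedure (described in the context) from $v_0$. If the search process ends with an empty sprout stack $S=\emptyset$, then every $M$-alternating path in $G$ starting from $v_0$ has been visited by the alternating path $P$ during the search, i.e. it occurred as (a prefix of) the path $P$ at some stage of the process.
   Context: A matching $M\subseteq E$ is a set of pairwise vertex-disjoint edges; edges in $M$ are matched, others are free; a vertex not covered by $M$ is free, and a covered vertex $v$ has a mate (the other endpoint of its matched edge). An $M$-alternating path is a path on distinct vertices whose edges alternate between free edges and edges of $M$; an $M$-alternating path starting at a free vertex $v_0$ begins with a free edge. An $M$-augmenting path is an $M$-alternating path whose two endpoints are both free. Trunk search from a free vertex $v_0$. The search maintains a trunk $T=\{P,S\}$, where $P$ is a sequence of vertices $v_0,\dots$ forming an $M$-alternating path starting at $v_0$, and $S$ is a stack (ordered list) of edges called sprouts. The parity $\pi(v)$ of a vertex $v$ on $P$ is $0$ if its distance from $v_0$ along $P$ is even and $1$ otherwise. A vertex $v$ on $P$ with $\pi(v)=0$ is an $s$-root, and $Sprout(v)$ denotes the set of free edges $\langle v,u\rangle\notin M$ incident with $v$. Initialization: choose $\langle v_0,v_1\rangle\in Sprout(v_0)$, set $P=v_0,v_1$ and $S=Sprout(v_0)\setminus\{\langle v_0,v_1\rangle\}$. Growing phase: if the last vertex of $P$ (which has parity $1$) is free, an augmenting path has been found and the search stops. Otherwise the path is extended by a pair $(v_a,v_b)$, where $v_a$ is the mate of the last vertex of $P$ (so $\pi(v_a)=0$)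 and $\langle v_a,v_b\rangle\in Sprout(v_a)$ is selected arbitrarily; if $v_a,v_b$ are not already in $P$, update $P\leftarrow P,v_a,v_b$ and push the edges of $Sprout(v_a)\setminus\{\langle v_a,v_b\rangle\}$ onto $S$. Pruning phase: when a dead end is reached (the path cannot be extended) or a cycle is formed (the extension revisits a vertex of $P$), then if $S=\emptyset$ the search stops declaring that no $M$-augmenting path starts at $v_0$; otherwise pop the last sprout $\langle v_a,v_b\rangle$ from $S$ (here $v_a$ lies on $P$), delete all vertices after $v_a$ in $P$, append $v_b$ (so $P=v_0,\dots,v_a,v_b$), and continue the search. -}

module Defs where

open import Data.Nat using (ℕ)
open import Data.Fin using (Fin)
open import Data.Bool using (Bool; true; false)
open import Data.List using (List; []; _∷_; _++_; _∷ʳ_)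
open import Data.List.Membership.Propositional using (_∈_; _∉_)
open import Data.List.Relation.Unary.Any using (Any)
open import Data.List.Relation.Unary.Unique.Propositional using (Unique)
open import Data.Product using (Σ; ∃; _×_; _,_; proj₁; proj₂)
open import Data.Sum using (_⊎_)
open import Relation.Nullary using (¬_)
open import Relation.Binary.PropositionalEquality using (_≡_; _≢_)

record Graph (n : ℕ) : Set where
  field
    adj     : Fin n → Fin n → Bool
    adj-sym : ∀ u v → adj u v ≡ adj v u
    adj-irr : ∀ v → adj v v ≡ false

  E : Fin n → Fin n → Set
  E u v = adj u v ≡ true

record Matching {n : ℕ} (G : Graph n) : Set where
  open Graph G
  field
    mat      : Fin n → Fin n → Bool
    mat-sym  : ∀ u v → mat u v ≡ mat v u
    mat⊆E    : ∀ u v → mat u v ≡ true → E u v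
    mat-disj : ∀ u v w → mat u v ≡ true → mat u w ≡ true → v ≡ w

  M : Fin n → Fin n → Set
  M u v = mat u v ≡ true

module Search {n : ℕ} (G : Graph n) (Mt : Matching G) (v0 : Fin n) where
  open Graph G
  open Matching Mt

  V : Set
  V = Fin n

  Free : V → Set
  Free v = ∀ u → ¬ M v u

  InSprout : V → V → Set
  InSprout a b = E a b × ¬ M a b

  Edge : Set
  Edge = V × V

  SproutRest : V → V → List Edge → Set
  SproutRest a b L =
    Unique L × (∀ e → (e ∈ L → proj₁ e ≡ a × InSprout a (proj₂ e) × proj₂ e ≢ b)
                    × (proj₁ e ≡ a × InSprout a (proj₂ e) × proj₂ e ≢ b → e ∈ L))

  -- Sprout stack: head of the list = top of the stack
  Stack : Set
  Stack = List Edge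

  Path : Set
  Path = List V

  data State : Set where
    start : State
    grow  : Path → Stack → State
    prune : Path → Stack → State
    found : Path → Stack → State
    noaug : State

  data Step : State → State → Set where
    init      : ∀ v1 L → InSprout v0 v1 → SproutRest v0 v1 L →
                Step start (grow (v0 ∷ v1 ∷ []) L)
    init-none : (∀ v1 → ¬ InSprout v0 v1) →
                Step start (prune (v0 ∷ []) [])
    aug       : ∀ P x S → Free x → Step (grow (P ∷ʳ x) S) (found (P ∷ʳ x) S)
    extend    : ∀ P x y z S L → M x y → InSprout y z → SproutRest y z L →
                y ∉ (P ∷ʳ x) → z ∉ (P ∷ʳ x ∷ʳ y) →
                Step (grow (P ∷ʳ x) S) (grow (P ∷ʳ x ∷ʳ y ∷ʳ z) (L ++ S))
    cycle     : ∀ P x y z S L → M x y → InSprout y z → SproutRest y z L →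
                (y ∈ (P ∷ʳ x) ⊎ z ∈ (P ∷ʳ x ∷ʳ y)) →
                Step (grow (P ∷ʳ x) S) (prune (P ∷ʳ x ∷ʳ y) (L ++ S))
    dead-end  : ∀ P x y S → M x y → (∀ z → ¬ InSprout y z) →
                Step (grow (P ∷ʳ x) S) (prune (P ∷ʳ x ∷ʳ y) S)
    stop      : ∀ P → Step (prune P []) noaug
    pop       : ∀ P Q R a b S → P ≡ Q ++ a ∷ R → a ∉ Q → b ∉ (Q ∷ʳ a) →
                Step (prune P ((a , b) ∷ S)) (grow (Q ++ a ∷ b ∷ []) S)
    pop-cycle : ∀ P Q R a b S → P ≡ Q ++ a ∷ R → a ∉ Q → b ∈ (Q ∷ʳ a) →
                Step (prune P ((a , b) ∷ S)) (prune (Q ∷ʳ a) S)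

  data Run : State → State → List State → Set where
    done : ∀ s → Run s s (s ∷ [])
    next : ∀ {s t u ss} → Step s t → Run t u ss → Run s u (s ∷ ss)

  EndsEmpty : State → Set
  EndsEmpty s = s ≡ noaug ⊎ Σ Path (λ P → s ≡ found P [])

  pathOf : State → Path
  pathOf start       = []
  pathOf (grow P _)  = P
  pathOf (prune P _) = P
  pathOf (found P _) = P
  pathOf noaug       = []

  -- M-alternating walks: Alt b xs, where b = true iff the next edge must be in M
  data Alt : Bool → Path → Set where
    single : ∀ {b} x → Alt b (x ∷ [])
    freeE  : ∀ {x y xs} → E x y → ¬ M x y → Alt true (y ∷ xs) → Alt false (x ∷ y ∷ xs)
    matE   : ∀ {x y xs} → M x y → Alt false (y ∷ xs) → Alt true (x ∷ y ∷ xs)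

  AltPathFrom : Path → Set
  AltPathFrom Q = Σ Path (λ xs → Q ≡ v0 ∷ xs) × Alt false Q × Unique Q

  Prefix : Path → Path → Set
  Prefix Q P = Σ Path (λ R → Q ++ R ≡ P)

  VisitedIn : List State → Path → Set
  VisitedIn ss Q = Any (λ s → Prefix Q (pathOf s)) ss

-- Fix an M-alternating path Q from v0 and follow the run until Q occurs as a
-- prefix of the trunk.  Until then either the trunk is itself a prefix of Q,
-- or some sprout on the stack is the edge along which Q leaves the trunk at
-- the first occurrence of that sprout's root.  While the trunk follows Q, the
-- growing phase is forced to follow Q one more step (the mate of the last
-- vertex is determined), and when the chosen sprout differs from the next
-- edge of Q, that edge is one of the pushed sprouts.  Popping the sprout along
-- which Q leaves puts the trunk back on Q, and cutting the trunk never loses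
-- it, because the stack is nested: every sprout below a sprout with root a is
-- rooted on the trunk prefix ending at a.  So Q is visited before the stack
-- runs empty.  The search never revisits a vertex when it extends the trunk
-- P ∷ʳ x by the mate of x, because P is closed under taking mates.
module Submission where

open import Defs
open import Data.Nat using (ℕ)
open import Data.Fin using (Fin; _≟_)
open import Data.Bool using (false; not)
open import Data.List using (List; []; _∷_; _++_; _∷ʳ_)
open import Data.List.Properties using (++-assoc; ++-identityʳ; ∷-injective; ∷ʳ-injective; ∷ʳ-++)
open import Data.List.Membership.Propositional using (_∈_; _∉_; lose)
open import Data.List.Membership.Propositional.Properties using (∈-++⁺ˡ; ∈-++⁺ʳ; ∈-++⁻)
open import Data.List.Relation.Unary.Any using (Any; here; there)
import Data.List.Relation.Unary.Any as Any
open import Data.List.Relation.Unary.Any.Properties using (++⁺ˡ; ++⁺ʳ)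
import Data.List.Relation.Unary.All as All
open import Data.List.Relation.Unary.AllPairs using (_∷_)
open import Data.List.Relation.Unary.Unique.Propositional using (Unique)
open import Data.Product using (Σ; _×_; _,_; proj₁; proj₂)
open import Data.Sum using (_⊎_; inj₁; inj₂)
open import Data.Unit using (⊤; tt)
open import Data.Empty using (⊥; ⊥-elim)
open import Relation.Nullary using (¬_; yes; no)
open import Relation.Binary.PropositionalEquality using (_≡_; _≢_; refl; sym; trans; cong; subst)

module _ {ℓ} {A : Set ℓ} where

  ∷ʳ-≢-[] : ∀ (xs : List A) {x} → xs ∷ʳ x ≢ []
  ∷ʳ-≢-[] []      ()
  ∷ʳ-≢-[] (_ ∷ _) ()

  unique-++-∷⇒∉ : ∀ (xs : List A) {x ys} → Unique (xs ++ x ∷ ys) → x ∉ xs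
  unique-++-∷⇒∉ (y ∷ xs) (y∉ ∷ _) (here refl) = All.lookup y∉ (∈-++⁺ʳ xs (here refl)) refl
  unique-++-∷⇒∉ (y ∷ xs) (_ ∷ u)  (there x∈)  = unique-++-∷⇒∉ xs u x∈

  ++-∷-first-occurrence : ∀ (xs ys : List A) {x us vs} →
    xs ++ x ∷ us ≡ ys ++ x ∷ vs → x ∉ xs → x ∉ ys → xs ≡ ys
  ++-∷-first-occurrence []       []       _  _     _     = refl
  ++-∷-first-occurrence []       (_ ∷ _)  eq _     x∉ys with refl , _ ← ∷-injective eq = ⊥-elim (x∉ys (here refl))
  ++-∷-first-occurrence (_ ∷ _)  []       eq x∉xs _    with refl , _ ← ∷-injective eq = ⊥-elim (x∉xs (here refl))
  ++-∷-first-occurrence (x ∷ xs) (_ ∷ ys) eq x∉xs x∉ys with refl , eq′ ← ∷-injective eq =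
    cong (x ∷_) (++-∷-first-occurrence xs ys eq′ (λ z → x∉xs (there z)) (λ z → x∉ys (there z)))

module TrunkSearch {n : ℕ} (G : Graph n) (Mt : Matching G) (v0 : Fin n) where
  open Graph G
  open Matching Mt
  open Search G Mt v0

  prefix-refl : ∀ {P} → Prefix P P
  prefix-refl {P} = [] , ++-identityʳ P

  prefix-trans : ∀ {K P T} → Prefix K P → Prefix P T → Prefix K T
  prefix-trans {K} (R , refl) (R′ , refl) = R ++ R′ , sym (++-assoc K R R′)

  prefix-∷ʳ : ∀ {P x} → Prefix P (P ∷ʳ x)
  prefix-∷ʳ {x = x} = x ∷ [] , refl

  prefix-of-≡ : ∀ {Q P} → Q ≡ P → Prefix Q P
  prefix-of-≡ refl = prefix-refl

  ≡-++-∷⇒prefix : ∀ {P} A {a R} → P ≡ A ++ a ∷ R → Prefix (A ∷ʳ a) P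
  ≡-++-∷⇒prefix A {a} {R} refl = R , ∷ʳ-++ A a R

  ≡-++-∷-∷⇒prefix : ∀ {Q} K {y z R} → Q ≡ K ++ y ∷ z ∷ R → Prefix (K ∷ʳ y ∷ʳ z) Q
  ≡-++-∷-∷⇒prefix K {y} {z} {R} refl = R , trans (∷ʳ-++ (K ∷ʳ y) z R) (∷ʳ-++ K y (z ∷ R))

  same-root : ∀ {A B P a} → Prefix (A ∷ʳ a) P → a ∉ A → Prefix (B ∷ʳ a) P → a ∉ B → A ≡ B
  same-root {A} {B} {a = a} (R , eqA) a∉A (R′ , eqB) a∉B =
    ++-∷-first-occurrence A B (trans (sym (∷ʳ-++ A a R)) (trans eqA (trans (sym eqB) (∷ʳ-++ B a R′)))) a∉A a∉B

  E-irrefl : ∀ {x} → ¬ E x x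
  E-irrefl {x} e with () ← trans (sym e) (adj-irr x)

  M-sym : ∀ {u w} → M u w → M w u
  M-sym {u} {w} m = trans (mat-sym w u) m

  M-irrefl : ∀ {x} → ¬ M x x
  M-irrefl {x} m = E-irrefl (mat⊆E x x m)

  MateClosed : Path → Set
  MateClosed P = ∀ {u w} → u ∈ P → M u w → w ∈ P

  mate-∉ : ∀ {P x y} → MateClosed P → x ∉ P → M x y → y ∉ P ∷ʳ x
  mate-∉ {P} closed x∉ m y∈ with ∈-++⁻ P y∈
  ... | inj₁ y∈P          = x∉ (closed y∈P (M-sym m))
  ... | inj₂ (here refl)  = M-irrefl m

  MateClosed-∷ʳ-mate : ∀ {P x y} → MateClosed P → M x y → MateClosed (P ∷ʳ x ∷ʳ y)
  MateClosed-∷ʳ-mate {P} {x} {y} closed m u∈ mu with ∈-++⁻ (P ∷ʳ x) u∈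
  ... | inj₂ (here refl) = subst (_∈ P ∷ʳ x ∷ʳ y) (mat-disj y x _ (M-sym m) mu) (∈-++⁺ˡ (∈-++⁺ʳ P (here refl)))
  ... | inj₁ u∈Px with ∈-++⁻ P u∈Px
  ...   | inj₁ u∈P         = ∈-++⁺ˡ (∈-++⁺ˡ (closed u∈P mu))
  ...   | inj₂ (here refl) = subst (_∈ P ∷ʳ x ∷ʳ y) (mat-disj x y _ m mu) (∈-++⁺ʳ (P ∷ʳ x) (here refl))

  MateClosed-v0 : Free v0 → MateClosed (v0 ∷ [])
  MateClosed-v0 free (here refl) m = ⊥-elim (free _ m)

  alt-tail : ∀ {c x y xs} → Alt c (x ∷ y ∷ xs) → Alt (not c) (y ∷ xs)
  alt-tail (freeE _ _ w) = w
  alt-tail (matE _ w)    = w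

  alt-matched-after : ∀ {c} K {x y R} → K ≢ [] → (∀ {u} → u ∈ K → ¬ M u x) →
                      Alt c (K ++ x ∷ y ∷ R) → M x y
  alt-matched-after []           K≢[] _    _                        = ⊥-elim (K≢[] refl)
  alt-matched-after (_ ∷ [])     _    _    (freeE _ _ (matE m _))  = m
  alt-matched-after (_ ∷ [])     _    free (matE m _)              = ⊥-elim (free (here refl) m)
  alt-matched-after (_ ∷ u ∷ K)  _    free w =
    alt-matched-after (u ∷ K) (λ ()) (λ u∈ → free (there u∈)) (alt-tail w)

  alt-free-after : ∀ {c} K {x y z R} → Alt c (K ++ x ∷ y ∷ z ∷ R) → M x y → InSprout y z
  alt-free-after []          (matE _ (freeE e ¬m _)) _ = e , ¬m
  alt-free-after []          (freeE _ ¬m _)          m = ⊥-elim (¬m m)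
  alt-free-after (_ ∷ [])    w m = alt-free-after [] (alt-tail w) m
  alt-free-after (_ ∷ u ∷ K) w m = alt-free-after (u ∷ K) (alt-tail w) m

  sprout-rest-root : ∀ {a b L e} → SproutRest a b L → e ∈ L → proj₁ e ≡ a
  sprout-rest-root {e = e} (_ , spec) e∈ = proj₁ (proj₁ (spec e) e∈)

  sprout-rest-∈ : ∀ {a b z L} → SproutRest a b L → InSprout a z → z ≢ b → (a , z) ∈ L
  sprout-rest-∈ (_ , spec) sp z≢b = proj₂ (spec _) (refl , sp , z≢b)

  Growable : Path → V → Set
  Growable P x = P ≢ [] × MateClosed P × x ∉ P

  GrowingTrunk : Path → Set
  GrowingTrunk T = Σ Path λ P → Σ V λ x → T ≡ P ∷ʳ x × Growable P x

  growable : ∀ P x → GrowingTrunk (P ∷ʳ x) → Growable P x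
  growable P x (P′ , x′ , eq , g) with refl , refl ← ∷ʳ-injective P P′ eq = g

  data Sprouts : Path → Stack → Set where
    []     : ∀ {P} → Sprouts P []
    sprout : ∀ {P A a b S} → Prefix (A ∷ʳ a) P → a ∉ A → MateClosed (A ∷ʳ a) →
             Sprouts (A ∷ʳ a) S → Sprouts P ((a , b) ∷ S)

  Sprouts-mono : ∀ {K P S} → Prefix K P → Sprouts K S → Sprouts P S
  Sprouts-mono _  []                        = []
  Sprouts-mono KP (sprout pre a∉ closed ss) = sprout (prefix-trans pre KP) a∉ closed ss

  Sprouts-push : ∀ {P A a S} L → (∀ {e} → e ∈ L → proj₁ e ≡ a) → Prefix (A ∷ʳ a) P → a ∉ A →
                 MateClosed (A ∷ʳ a) → Sprouts (A ∷ʳ a) S → Sprouts P (L ++ S)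
  Sprouts-push []      _    pre _  _      ss = Sprouts-mono pre ss
  Sprouts-push (_ ∷ L) root pre a∉ closed ss with refl ← root (here refl) =
    sprout pre a∉ closed (Sprouts-push L (λ e∈ → root (there e∈)) prefix-refl a∉ closed ss)

  Invariant : State → Set
  Invariant (grow T S)  = GrowingTrunk T × Sprouts T S
  Invariant (prune T S) = Sprouts T S
  Invariant _           = ⊤

  module _ (free0 : Free v0) where

    step-invariant : ∀ {s t} → Step s t → Invariant s → Invariant t
    step-invariant (init v1 L (e , _) rest) _ =
      (v0 ∷ [] , v1 , refl , (λ ()) , MateClosed-v0 free0 , v1∉)
      , subst (Sprouts (v0 ∷ v1 ∷ [])) (++-identityʳ L)
          (Sprouts-push {A = []} L (sprout-rest-root rest) prefix-∷ʳ (λ ()) (MateClosed-v0 free0) [])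
      where
        v1∉ : v1 ∉ v0 ∷ []
        v1∉ (here refl) = E-irrefl e
    step-invariant (init-none _) _ = []
    step-invariant (aug _ _ _ _) _ = tt
    step-invariant (extend P x y z _ L m _ rest y∉ z∉) (trunk , ss)
      with _ , closed , _ ← growable P x trunk =
      (P ∷ʳ x ∷ʳ y , z , refl , ∷ʳ-≢-[] (P ∷ʳ x) , MateClosed-∷ʳ-mate closed m , z∉)
      , Sprouts-push L (sprout-rest-root rest) prefix-∷ʳ y∉ (MateClosed-∷ʳ-mate closed m)
          (Sprouts-mono prefix-∷ʳ ss)
    step-invariant (cycle P x _ _ _ L m _ rest _) (trunk , ss)
      with _ , closed , x∉ ← growable P x trunk =
      Sprouts-push L (sprout-rest-root rest) prefix-refl (mate-∉ closed x∉ m)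
        (MateClosed-∷ʳ-mate closed m) (Sprouts-mono prefix-∷ʳ ss)
    step-invariant (dead-end _ _ _ _ _ _) (_ , ss) = Sprouts-mono prefix-∷ʳ ss
    step-invariant (stop _) _ = tt
    step-invariant (pop _ A′ _ a b _ eq a∉ b∉) (sprout {A = A} pre a∉A closed ss)
      with refl ← same-root pre a∉A (≡-++-∷⇒prefix A′ eq) a∉ =
      (A ∷ʳ a , b , sym (∷ʳ-++ A a (b ∷ [])) , ∷ʳ-≢-[] A , closed , b∉)
      , Sprouts-mono (b ∷ [] , ∷ʳ-++ A a (b ∷ [])) ss
    step-invariant (pop-cycle _ A′ _ _ _ _ eq a∉ _) (sprout pre a∉A _ ss)
      with refl ← same-root pre a∉A (≡-++-∷⇒prefix A′ eq) a∉ = ss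

    module Following (Q : Path) (Q-start : Σ Path λ xs → Q ≡ v0 ∷ xs)
                     (altQ : Alt false Q) (uniqueQ : Unique Q) where

      data Leaves (P : Path) : Edge → Set where
        leaves : ∀ {a b} K R → Q ≡ K ++ a ∷ b ∷ R → a ∉ K → Prefix (K ∷ʳ a) P → Leaves P (a , b)

      Leaves-mono : ∀ {P P′ e} → Prefix P P′ → Leaves P e → Leaves P′ e
      Leaves-mono PP′ (leaves K R eq a∉ pre) = leaves K R eq a∉ (prefix-trans pre PP′)

      Leaves-cut : ∀ {K P S} → Sprouts K S → Prefix K P → Any (Leaves P) S → Any (Leaves K) S
      Leaves-cut (sprout pre a∉ _ _) KP (here (leaves K R eq a∉K preK))
        with refl ← same-root (prefix-trans pre KP) a∉ preK a∉K = here (leaves K R eq a∉K pre)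
      Leaves-cut (sprout pre _ _ ss) KP (there p) =
        there (Any.map (Leaves-mono pre) (Leaves-cut ss (prefix-trans pre KP) p))

      stackOf : State → Stack
      stackOf (grow _ S)  = S
      stackOf (prune _ S) = S
      stackOf (found _ S) = S
      stackOf _           = []

      TrunkOnQ : State → Set
      TrunkOnQ start      = ⊤
      TrunkOnQ (grow P _) = Prefix P Q
      TrunkOnQ _          = ⊥

      data Tracked (s : State) : Set where
        visited : Prefix Q (pathOf s) → Tracked s
        on-Q    : TrunkOnQ s → Tracked s
        stacked : Any (Leaves (pathOf s)) (stackOf s) → Tracked s

      data Continuation (P : Path) (x : V) : Set where
        stops   : Q ≡ P ∷ʳ x → Continuation P x
        to-mate : ∀ {y} → M x y → Q ≡ P ∷ʳ x ∷ʳ y → Continuation P x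
        through : ∀ {y z} R → M x y → InSprout y z → Q ≡ (P ∷ʳ x) ++ y ∷ z ∷ R → Continuation P x

      altQ-split : ∀ {P x R} → (P ∷ʳ x) ++ R ≡ Q → Alt false (P ++ x ∷ R)
      altQ-split {P} {x} {R} eq = subst (Alt false) (trans (sym eq) (∷ʳ-++ P x R)) altQ

      matched-after : ∀ {P x y R} → Growable P x → (P ∷ʳ x) ++ y ∷ R ≡ Q → M x y
      matched-after {P} (P≢[] , closed , x∉) eq =
        alt-matched-after P P≢[] (λ u∈ m → x∉ (closed u∈ m)) (altQ-split eq)

      continuation : ∀ {P x} → Growable P x → Prefix (P ∷ʳ x) Q → Continuation P x
      continuation {P} {x} _ ([] , eq) = stops (trans (sym eq) (++-identityʳ (P ∷ʳ x)))
      continuation g (_ ∷ [] , eq) = to-mate (matched-after g eq) (sym eq)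
      continuation {P} g (_ ∷ _ ∷ R , eq) =
        through R (matched-after g eq) (alt-free-after P (altQ-split eq) (matched-after g eq)) (sym eq)

      follow-init : ∀ {v1 L} → SproutRest v0 v1 L → Tracked (grow (v0 ∷ v1 ∷ []) L)
      follow-init {v1} {L} rest = from-start Q-start altQ
        where
          from-start : (Σ Path λ xs → Q ≡ v0 ∷ xs) → Alt false Q → Tracked (grow (v0 ∷ v1 ∷ []) L)
          from-start ([] , refl) _ = visited (v1 ∷ [] , refl)
          from-start (y ∷ R , refl) (freeE e ¬m _) with y ≟ v1
          ... | yes refl = on-Q (R , refl)
          ... | no y≢v1  = stacked (lose (sprout-rest-∈ rest (e , ¬m) y≢v1) (leaves [] R refl (λ ()) prefix-∷ʳ))

      follow-init-none : (∀ v1 → ¬ InSprout v0 v1) → Tracked (prune (v0 ∷ []) [])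
      follow-init-none none = from-start Q-start altQ
        where
          from-start : (Σ Path λ xs → Q ≡ v0 ∷ xs) → Alt false Q → Tracked (prune (v0 ∷ []) [])
          from-start ([] , refl)    _              = visited prefix-refl
          from-start (y ∷ _ , refl) (freeE e ¬m _) = ⊥-elim (none y (e , ¬m))

      stops-at-free : ∀ {P x} → Free x → Continuation P x → Prefix Q (P ∷ʳ x)
      stops-at-free _    (stops eq)         = prefix-of-≡ eq
      stops-at-free free (to-mate m _)      = ⊥-elim (free _ m)
      stops-at-free free (through _ m _ _)  = ⊥-elim (free _ m)

      follow-extend : ∀ {P x y z S L} → M x y → SproutRest y z L → y ∉ P ∷ʳ x → Continuation P x →
                      Prefix Q (P ∷ʳ x) ⊎ Tracked (grow (P ∷ʳ x ∷ʳ y ∷ʳ z) (L ++ S))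
      follow-extend _ _ _ (stops eq) = inj₁ (prefix-of-≡ eq)
      follow-extend {x = x} {z = z} m _ _ (to-mate m′ eq)
        with refl ← mat-disj x _ _ m m′ = inj₂ (visited (z ∷ [] , cong (_∷ʳ z) eq))
      follow-extend {P} {x} {z = z} m rest y∉ (through {z = z′} R m′ sp eq)
        with refl ← mat-disj x _ _ m m′ | z′ ≟ z
      ... | yes refl = inj₂ (on-Q (≡-++-∷-∷⇒prefix (P ∷ʳ x) eq))
      ... | no z′≢z  = inj₂ (stacked (++⁺ˡ (lose (sprout-rest-∈ rest sp z′≢z)
                                               (leaves (P ∷ʳ x) R eq y∉ prefix-∷ʳ))))

      follow-cycle : ∀ {P x y z S L} → M x y → SproutRest y z L → y ∉ P ∷ʳ x →
                     y ∈ P ∷ʳ x ⊎ z ∈ P ∷ʳ x ∷ʳ y → Continuation P x →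
                     Prefix Q (P ∷ʳ x) ⊎ Tracked (prune (P ∷ʳ x ∷ʳ y) (L ++ S))
      follow-cycle _ _ _ _ (stops eq) = inj₁ (prefix-of-≡ eq)
      follow-cycle {x = x} m _ _ _ (to-mate m′ eq)
        with refl ← mat-disj x _ _ m m′ = inj₂ (visited (prefix-of-≡ eq))
      follow-cycle {P} {x} {y} {z} m rest y∉ closes (through {z = z′} R m′ sp eq)
        with refl ← mat-disj x _ _ m m′ | z′ ≟ z
      ... | no z′≢z = inj₂ (stacked (++⁺ˡ (lose (sprout-rest-∈ rest sp z′≢z)
                                              (leaves (P ∷ʳ x) R eq y∉ prefix-refl))))
      ... | yes refl with closes
      ...   | inj₁ y∈ = ⊥-elim (y∉ y∈)
      ...   | inj₂ z∈ = ⊥-elim (unique-++-∷⇒∉ (P ∷ʳ x ∷ʳ y)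
                          (subst Unique (trans eq (sym (∷ʳ-++ (P ∷ʳ x) y (z ∷ R)))) uniqueQ) z∈)

      follow-dead-end : ∀ {P x y S} → M x y → (∀ z → ¬ InSprout y z) → Continuation P x →
                        Prefix Q (P ∷ʳ x) ⊎ Tracked (prune (P ∷ʳ x ∷ʳ y) S)
      follow-dead-end _ _ (stops eq) = inj₁ (prefix-of-≡ eq)
      follow-dead-end {x = x} m _ (to-mate m′ eq)
        with refl ← mat-disj x _ _ m m′ = inj₂ (visited (prefix-of-≡ eq))
      follow-dead-end {x = x} m none (through _ m′ sp _)
        with refl ← mat-disj x _ _ m m′ = ⊥-elim (none _ sp)

      follow-pop : ∀ {P A a b S R} → Sprouts P ((a , b) ∷ S) → P ≡ A ++ a ∷ R → a ∉ A →
                   Any (Leaves P) ((a , b) ∷ S) → Tracked (grow (A ++ a ∷ b ∷ []) S)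
      follow-pop {A = A} (sprout pre a∉A _ _) eq a∉ (here (leaves K R eqQ a∉K preK))
        with refl ← same-root preK a∉K (≡-++-∷⇒prefix A eq) a∉ =
        on-Q (R , trans (++-assoc K _ R) (sym eqQ))
      follow-pop {A = A} {a} {b} (sprout pre a∉A _ ss) eq a∉ (there p)
        with refl ← same-root pre a∉A (≡-++-∷⇒prefix A eq) a∉ =
        stacked (Any.map (Leaves-mono (b ∷ [] , ∷ʳ-++ A a (b ∷ []))) (Leaves-cut ss pre p))

      follow-pop-cycle : ∀ {P A a b S R} → Sprouts P ((a , b) ∷ S) → P ≡ A ++ a ∷ R → a ∉ A →
                         b ∈ A ∷ʳ a → Any (Leaves P) ((a , b) ∷ S) → Tracked (prune (A ∷ʳ a) S)
      follow-pop-cycle {A = A} {a} {b} _ eq a∉ b∈ (here (leaves K R eqQ a∉K preK))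
        with refl ← same-root preK a∉K (≡-++-∷⇒prefix A eq) a∉ =
        ⊥-elim (unique-++-∷⇒∉ (A ∷ʳ a) (subst Unique (trans eqQ (sym (∷ʳ-++ A a (b ∷ R)))) uniqueQ) b∈)
      follow-pop-cycle {A = A} (sprout pre a∉A _ ss) eq a∉ _ (there p)
        with refl ← same-root pre a∉A (≡-++-∷⇒prefix A eq) a∉ = stacked (Leaves-cut ss pre p)

      from-grow : ∀ {P x S t} → Growable P x →
                  (Continuation P x → Prefix Q (P ∷ʳ x) ⊎ Tracked t) →
                  (Any (Leaves (P ∷ʳ x)) S → Tracked t) →
                  Tracked (grow (P ∷ʳ x) S) → Prefix Q (P ∷ʳ x) ⊎ Tracked t
      from-grow _ _   _   (visited p) = inj₁ p
      from-grow g onQ _   (on-Q pre)  = onQ (continuation g pre)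
      from-grow _ _   onS (stacked p) = inj₂ (onS p)

      from-prune : ∀ {P S t} → (Any (Leaves P) S → Prefix Q P ⊎ Tracked t) →
                   Tracked (prune P S) → Prefix Q P ⊎ Tracked t
      from-prune _   (visited p) = inj₁ p
      from-prune onS (stacked p) = onS p

      tracked-step : ∀ {s t} → Step s t → Invariant s → Tracked s → Prefix Q (pathOf s) ⊎ Tracked t
      tracked-step (init _ _ _ rest) _ _ = inj₂ (follow-init rest)
      tracked-step (init-none none)  _ _ = inj₂ (follow-init-none none)
      tracked-step (aug P x _ free) (trunk , _) =
        from-grow (growable P x trunk) (λ c → inj₁ (stops-at-free free c)) stacked
      tracked-step (extend P x y z _ L m _ rest y∉ _) (trunk , _) =
        from-grow (growable P x trunk) (follow-extend m rest y∉)
          (λ p → stacked (++⁺ʳ L (Any.map (Leaves-mono (y ∷ z ∷ [] , sym (∷ʳ-++ (P ∷ʳ x) y (z ∷ [])))) p)))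
      tracked-step (cycle P x y _ _ L m _ rest closes) (trunk , _)
        with g@(_ , closed , x∉) ← growable P x trunk =
        from-grow g (follow-cycle m rest (mate-∉ closed x∉ m) closes)
          (λ p → stacked (++⁺ʳ L (Any.map (Leaves-mono prefix-∷ʳ) p)))
      tracked-step (dead-end P x _ _ m none) (trunk , _) =
        from-grow (growable P x trunk) (follow-dead-end m none)
          (λ p → stacked (Any.map (Leaves-mono prefix-∷ʳ) p))
      tracked-step (stop _) _ = from-prune (λ ())
      tracked-step (pop _ _ _ _ _ _ eq a∉ _) ss = from-prune (λ p → inj₂ (follow-pop ss eq a∉ p))
      tracked-step (pop-cycle _ _ _ _ _ _ eq a∉ b∈) ss =
        from-prune (λ p → inj₂ (follow-pop-cycle ss eq a∉ b∈ p))

      tracked-at-end : ∀ {s} → EndsEmpty s → Tracked s → Prefix Q (pathOf s)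
      tracked-at-end _                 (visited p)  = p
      tracked-at-end (inj₁ refl)       (on-Q ())
      tracked-at-end (inj₁ refl)       (stacked ())
      tracked-at-end (inj₂ (_ , refl)) (on-Q ())
      tracked-at-end (inj₂ (_ , refl)) (stacked ())

      visits : ∀ {s fin ss} → Run s fin ss → Invariant s → Tracked s → EndsEmpty fin → VisitedIn ss Q
      visits (done _)    _   tr ends = here (tracked-at-end ends tr)
      visits (next st r) inv tr ends with tracked-step st inv tr
      ... | inj₁ p   = here p
      ... | inj₂ tr′ = there (visits r (step-invariant st inv) tr′ ends)

lemma2 : {n : ℕ} (G : Graph n) (M : Matching G) (v0 : Fin n) →
    Search.Free G M v0 v0 →
    (fin : Search.State G M v0) (ss : List (Search.State G M v0)) →
    Search.Run G M v0 (Search.start) fin ss →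
    Search.EndsEmpty G M v0 fin →
    (Q : List (Fin n)) → Search.AltPathFrom G M v0 Q →
    Search.VisitedIn G M v0 ss Q
lemma2 G M v0 free0 _ _ run ends Q (start , altQ , uniqueQ) =
  visits run tt (on-Q tt) ends
  where open TrunkSearch.Following G M v0 free0 Q start altQ uniqueQ
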